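{- Let $\mathbf{p}=(k,m,n,(G_1,\bar y^1,\bar z^1),G_2)\in\mathbf{CR}$. If $x_0,\dots,x_{k-1}\in G_2$, then there is $I_*\subseteq[0,n)$ such that: (a) $|I_*|=n/2^k$ $(=m)$; (b) for every $\ell<k$, $\mathcal{U}_2(x_\ell)\cap I_*\in\{I_*,\emptyset\}$.
   Context: Commutators are $[a,b]=a^{ -1}b^{ -1}ab$, $e$ is the identity, $n<\omega$ is identified with $\{0,\dots,n-1\}$, $[n]^m$ is the set of $m$-element subsets of $n$, and for a sequence $(g_i:i<n)$ and $I\subseteq n$, $g_I=\prod_{i\in I}g_i$ ($g_\emptyset=e$). For $2\le 4m\le n$ with $\frac{2}{2^m}+\frac1{n^2}<\frac1m$, $\mathbf{CR}_{(n,m)}$ is the class of triples $(G,\bar y,\bar z)$ with: $G$ a finite group; $\bar y=(y_i:i<n)$ pairwise commuting elements of order $2$ with $|\langle\bar y\rangle_G|=2^n$; $\bar z=(z_I:I\in[n]^m)$, $z_I\in G$; for every $I\subseteq n$ and $J\in[n]^m$, $[y_I,z_J]=e$ iff $I\in\{J,\emptyset\}$; and for $s\in G\setminus\{e\}$, $|\{t\in G:[s,t]=e\}|<|G|/n^2$. $\mathbf{CR}$ is the set of tuples $\mathbf{p}=(k,m,n,(G_1,\bar y^1,\bar z^1),G_2)$ such that: $0<k<m<n<\omega$; $2\le 4m\le n$; $2^k m=n$ and $k\ll n$; $\frac{2}{2^m}+\frac1{n^2}<\frac1m$; $(G_1,\bar y^1,\bar z^1)\in\mathbf{CR}_{(n,m)}$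 (write $\bar y^1=(y^1_i:i<n)$, $\bar z^1=(z^1_I:I\in[n]^m)$); and, letting $\mathfrak c:n\times n\to G_1$ be $\mathfrak c(i,j)=e$ for $i\neq j$ and $\mathfrak c(i,i)=y^1_i$, $G_2$ is the group generated by $G_1\cup\{y^\ell_i:\ell\in\{2,3\},i<n\}$ freely except for: the relations of $G_1$; $(y^\ell_i)^2=e$; $y^\ell_i$ and $y^\ell_j$ commute for each $\ell\in\{2,3\}$; each $y^\ell_i$ commutes with every element of $G_1$; and $[y^2_i,y^3_j]=\mathfrak c(i,j)$. Every $x\in G_2$ can be written uniquely as $x=y_{(3,\mathcal U_3(x))}\,y_{(2,\mathcal U_2(x))}\,y_{(1,x)}$ with $\mathcal U_2(x),\mathcal U_3(x)\subseteq[0,n)$ and $y_{(1,x)}\in G_1$, where $y_{(\ell,U)}=\prod_{i\in U}y^\ell_i$; this defines $\mathcal U_2(x)$. -}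

module Defs where

open import Level using (0ℓ)
open import Algebra.Bundles using (Group)
open import Data.Nat using (ℕ; zero; suc; _+_; _*_; _^_; _≤_; _<_)
open import Data.Fin using (Fin)
import Data.Fin as F
open import Data.Fin.Subset using (Subset; ∣_∣; _∩_; ⊥; inside)
open import Data.Vec using (Vec; []; _∷_; tabulate)
open import Data.Bool using (Bool; true; false; if_then_else_)
open import Data.Product using (Σ; ∃; _×_; _,_)
open import Data.Sum using (_⊎_)
open import Relation.Nullary using (¬_; does)
open import Relation.Binary.Definitions using (Decidable)
open import Relation.Binary.PropositionalEquality using (_≡_)

-- A finite group: a stdlib group (setoid equality _≈_) with decidable
-- equality and an enumeration Fin card → Carrier that is a bijection
-- up to _≈_.  |G| = card.
record FiniteGroup : Set₁ where
  field
    grp : Group 0ℓ 0ℓ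
  open Group grp
  field
    _≟_       : Decidable _≈_
    card      : ℕ
    enum      : Fin card → Carrier
    enum-inj  : ∀ i j → enum i ≈ enum j → i ≡ j
    enum-surj : ∀ g → ∃ λ i → enum i ≈ g

module FG (G : FiniteGroup) where
  open FiniteGroup G public
  open Group grp public

  comm : Carrier → Carrier → Carrier
  comm a b = a ⁻¹ ∙ b ⁻¹ ∙ a ∙ b

  prodSub : ∀ {n} → (Fin n → Carrier) → Subset n → Carrier
  prodSub {zero}  g []      = ε
  prodSub {suc n} g (b ∷ I) = (if b then g F.zero else ε) ∙ prodSub (λ i → g (F.suc i)) I

  centralizerSize : Carrier → ℕ
  centralizerSize s = ∣ tabulate (λ i → does (comm s (enum i) ≟ ε)) ∣

-- The class CR_(n,m) (the numerical side conditions on n,m are recorded in CR).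
record CRnm (n m : ℕ) : Set₁ where
  field
    G : FiniteGroup
  open FG G
  field
    y        : Fin n → Carrier
    y-order2 : ∀ i → (y i ∙ y i ≈ ε) × ¬ (y i ≈ ε)
    y-comm   : ∀ i j → y i ∙ y j ≈ y j ∙ y i
    -- |⟨ȳ⟩| = 2^n  (for pairwise commuting involutions, ⟨ȳ⟩ = {y_I : I ⊆ n},
    -- so this says that I ↦ y_I is injective)
    y-free   : ∀ (I J : Subset n) → prodSub y I ≈ prodSub y J → I ≡ J
    z        : (J : Subset n) → ∣ J ∣ ≡ m → Carrier
    yz       : ∀ (I J : Subset n) (hJ : ∣ J ∣ ≡ m) →
               ((comm (prodSub y I) (z J hJ) ≈ ε) → (I ≡ J ⊎ I ≡ ⊥)) ×
               ((I ≡ J ⊎ I ≡ ⊥) → (comm (prodSub y I) (z J hJ) ≈ ε))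
    centr    : ∀ s → ¬ (s ≈ ε) → centralizerSize s * (n * n) < card

-- The class CR (the informal side condition "k ≪ n" is not formalized).
record CR : Set₁ where
  field
    k m n   : ℕ
    0<k     : 0 < k
    k<m     : k < m
    m<n     : m < n
    2≤4m    : 2 ≤ 4 * m
    4m≤n    : 4 * m ≤ n
    2^km≡n  : 2 ^ k * m ≡ n
    -- 2/2^m + 1/n² < 1/m, multiplied through by m·2^m·n² > 0
    ineq    : 2 * m * (n * n) + m * 2 ^ m < 2 ^ m * (n * n)
    G1      : CRnm n m

-- G₂, realised by the unique normal forms x = y_(3,U₃) y_(2,U₂) y_(1,x).
module G₂ (p : CR) where
  open CR p
  open CRnm G1 using (G; y)
  open FG G

  record Elem : Set where
    constructor nf
    field
      U₃ : Subset n
      U₂ : Subset n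
      y₁ : Carrier

  -- multiplication derived from the defining relations:
  -- y²_B y³_C = y³_C y²_B y¹_{B∩C}, all y^ℓ_i central over G₁
  _·_ : Elem → Elem → Elem
  nf A B g · nf C D h = nf (A ⊕ C) (B ⊕ D) (prodSub y (B ∩ C) ∙ g ∙ h)
    where
    _⊕_ : ∀ {r} → Subset r → Subset r → Subset r
    [] ⊕ [] = []
    (a ∷ as) ⊕ (b ∷ bs) = (if a then (if b then false else true) else b) ∷ (as ⊕ bs)

  e : Elem
  e = nf ⊥ ⊥ ε

G₂Elem : CR → Set
G₂Elem p = G₂.Elem p

𝒰₂ : (p : CR) → G₂Elem p → Subset (CR.n p)
𝒰₂ p x = G₂.Elem.U₂ {p} x

module Submission where

open import Defs
open import Data.Fin using (Fin; zero; suc)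
open import Data.Fin.Subset
  using (Subset; ∣_∣; _∩_; ⊥; ⊤; ∁; _⊆_; inside; outside)
open import Data.Fin.Subset.Properties
  using (⊆-trans; ⊆-antisym; out⊆; in⊆in; ⊥⊆; ∣⊥∣≡0; ∣⊤∣≡n;
         p∩q⊆p; p∩q⊆q; x∈p∩q⁺; x∈p∩q⁻; x∈p⇒x∉∁p; Empty-unique)
open import Data.Nat using (zero; suc; _+_; _*_; _^_; _≤_; s≤s)
open import Data.Nat.Properties
  using (≤-trans; ≤-reflexive; +-suc; +-identityʳ; *-assoc; _≤?_; ≰⇒>; <⇒≤;
         +-monoˡ-≤; +-cancelˡ-≤)
open import Data.Product using (∃; _×_; _,_)
open import Data.Sum using (_⊎_; inj₁; inj₂)
import Data.Sum as Sum
open import Data.Vec using (_∷_; [])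
open import Relation.Nullary using (yes; no)
open import Relation.Binary.PropositionalEquality using (_≡_; refl; cong; sym; trans; subst)

-- Split [0,n) by 𝒰₂(x₀), keep a half of size ≥ 2^(k-1) m, split that by 𝒰₂(x₁), and so on.
-- After k halvings we hold at least m points on which every 𝒰₂(x_ℓ) is all or nothing;
-- any m of them form I*.

Homogeneous : ∀ {n} → Subset n → Subset n → Set
Homogeneous U T = T ⊆ U ⊎ T ⊆ ∁ U

Homogeneous-⊆ : ∀ {n} {U T T′ : Subset n} → T′ ⊆ T → Homogeneous U T → Homogeneous U T′
Homogeneous-⊆ T′⊆T = Sum.map (⊆-trans T′⊆T) (⊆-trans T′⊆T)

⊆⇒∩≡ : ∀ {n} {U T : Subset n} → T ⊆ U → U ∩ T ≡ T
⊆⇒∩≡ {U = U} {T} T⊆U = ⊆-antisym (p∩q⊆q U T) (λ x∈T → x∈p∩q⁺ (T⊆U x∈T , x∈T))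

⊆∁⇒∩≡⊥ : ∀ {n} {U T : Subset n} → T ⊆ ∁ U → U ∩ T ≡ ⊥
⊆∁⇒∩≡⊥ {U = U} {T} T⊆∁U = Empty-unique λ where
  (x , x∈U∩T) → let (x∈U , x∈T) = x∈p∩q⁻ U T x∈U∩T in x∈p⇒x∉∁p x∈U (T⊆∁U x∈T)

Homogeneous⇒∩≡⊎∩≡⊥ : ∀ {n} {U T : Subset n} → Homogeneous U T → U ∩ T ≡ T ⊎ U ∩ T ≡ ⊥
Homogeneous⇒∩≡⊎∩≡⊥ = Sum.map ⊆⇒∩≡ ⊆∁⇒∩≡⊥

∣p∩q∣+∣p∩∁q∣≡∣p∣ : ∀ {n} (p q : Subset n) → ∣ p ∩ q ∣ + ∣ p ∩ ∁ q ∣ ≡ ∣ p ∣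
∣p∩q∣+∣p∩∁q∣≡∣p∣ []            []            = refl
∣p∩q∣+∣p∩∁q∣≡∣p∣ (inside  ∷ p) (inside  ∷ q) = cong suc (∣p∩q∣+∣p∩∁q∣≡∣p∣ p q)
∣p∩q∣+∣p∩∁q∣≡∣p∣ (inside  ∷ p) (outside ∷ q) =
  trans (+-suc ∣ p ∩ q ∣ _) (cong suc (∣p∩q∣+∣p∩∁q∣≡∣p∣ p q))
∣p∩q∣+∣p∩∁q∣≡∣p∣ (outside ∷ p) (inside  ∷ q) = ∣p∩q∣+∣p∩∁q∣≡∣p∣ p q
∣p∩q∣+∣p∩∁q∣≡∣p∣ (outside ∷ p) (outside ∷ q) = ∣p∩q∣+∣p∩∁q∣≡∣p∣ p q

⊆-ofSize : ∀ {n} m (p : Subset n) → m ≤ ∣ p ∣ → ∃ λ q → q ⊆ p × ∣ q ∣ ≡ m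
⊆-ofSize {n} zero p _ = ⊥ , ⊥⊆ , ∣⊥∣≡0 n
⊆-ofSize (suc m) (inside ∷ p) (s≤s m≤∣p∣) with ⊆-ofSize m p m≤∣p∣
... | q , q⊆p , ∣q∣≡m = inside ∷ q , in⊆in q⊆p , cong suc ∣q∣≡m
⊆-ofSize (suc m) (outside ∷ p) m<∣p∣ with ⊆-ofSize (suc m) p m<∣p∣
... | q , q⊆p , ∣q∣≡m = outside ∷ q , out⊆ q⊆p , ∣q∣≡m

largeHalf : ∀ {n} a (S U : Subset n) → a + a ≤ ∣ S ∣ → a ≤ ∣ S ∩ U ∣ ⊎ a ≤ ∣ S ∩ ∁ U ∣
largeHalf a S U a+a≤∣S∣ with a ≤? ∣ S ∩ U ∣
... | yes a≤∣S∩U∣ = inj₁ a≤∣S∩U∣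
... | no  a≰∣S∩U∣ = inj₂ (+-cancelˡ-≤ a a _ (≤-trans a+a≤∣S∣ ∣S∣≤a+∣S∩∁U∣))
  where
  ∣S∣≤a+∣S∩∁U∣ : ∣ S ∣ ≤ a + ∣ S ∩ ∁ U ∣
  ∣S∣≤a+∣S∩∁U∣ = subst (_≤ a + ∣ S ∩ ∁ U ∣) (∣p∩q∣+∣p∩∁q∣≡∣p∣ S U)
                   (+-monoˡ-≤ _ (<⇒≤ (≰⇒> a≰∣S∩U∣)))

homogeneousHalf : ∀ {n} a (U S : Subset n) → 2 * a ≤ ∣ S ∣ →
  ∃ λ T → T ⊆ S × a ≤ ∣ T ∣ × Homogeneous U T
homogeneousHalf a U S 2a≤∣S∣
  with largeHalf a S U (subst (_≤ ∣ S ∣) (cong (a +_) (+-identityʳ a)) 2a≤∣S∣)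
... | inj₁ a≤∣S∩U∣  = S ∩ U   , p∩q⊆p S U   , a≤∣S∩U∣  , inj₁ (p∩q⊆q S U)
... | inj₂ a≤∣S∩∁U∣ = S ∩ ∁ U , p∩q⊆p S (∁ U) , a≤∣S∩∁U∣ , inj₂ (p∩q⊆q S (∁ U))

homogeneousSubset : ∀ {n} m j (Us : Fin j → Subset n) (S : Subset n) → 2 ^ j * m ≤ ∣ S ∣ →
  ∃ λ T → T ⊆ S × ∣ T ∣ ≡ m × (∀ ℓ → Homogeneous (Us ℓ) T)
homogeneousSubset m zero Us S m≤∣S∣
  with ⊆-ofSize m S (subst (_≤ ∣ S ∣) (+-identityʳ m) m≤∣S∣)
... | T , T⊆S , ∣T∣≡m = T , T⊆S , ∣T∣≡m , λ ()
homogeneousSubset m (suc j) Us S 2^[1+j]m≤∣S∣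
  with homogeneousHalf (2 ^ j * m) (Us zero) S
         (subst (_≤ ∣ S ∣) (*-assoc 2 (2 ^ j) m) 2^[1+j]m≤∣S∣)
... | S′ , S′⊆S , 2^jm≤∣S′∣ , hom₀
  with homogeneousSubset m j (λ ℓ → Us (suc ℓ)) S′ 2^jm≤∣S′∣
... | T , T⊆S′ , ∣T∣≡m , hom = T , ⊆-trans T⊆S′ S′⊆S , ∣T∣≡m , λ where
  zero    → Homogeneous-⊆ T⊆S′ hom₀
  (suc ℓ) → hom ℓ

lemma3p7 : (p : CR) (x : Fin (CR.k p) → G₂Elem p) →
    ∃ λ (I* : Subset (CR.n p)) →
    (∣ I* ∣ ≡ CR.m p) ×
    (∀ ℓ → (𝒰₂ p (x ℓ) ∩ I* ≡ I*) ⊎ (𝒰₂ p (x ℓ) ∩ I* ≡ ⊥))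
lemma3p7 p x with homogeneousSubset m k (λ ℓ → 𝒰₂ p (x ℓ)) ⊤ 2^km≤∣⊤∣
  where
  open CR p
  2^km≤∣⊤∣ : 2 ^ k * m ≤ ∣ ⊤ {n} ∣
  2^km≤∣⊤∣ = ≤-reflexive (trans 2^km≡n (sym (∣⊤∣≡n n)))
... | I* , _ , ∣I*∣≡m , hom = I* , ∣I*∣≡m , λ ℓ → Homogeneous⇒∩≡⊎∩≡⊥ (hom ℓ)
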